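{- $\chi_i^{c}(K_4^{+})=7$, where $K_4^+$ is the graph obtained from $K_4$ by subdividing one edge once.
   Context: An incidence of a graph $G$ is a pair $(v,e)$ with $v$ an endpoint of the edge $e$; for a vertex $w$, $I(w)$ is the set of incidences $(u,e)$ with $e$ incident with $w$; two incidences conflict if both lie in some $I(w)$; a conflict-free incidence $k$-coloring assigns colors from a $k$-set to incidences so that conflicting incidences get distinct colors; $\chi^{c}_i(G)$ is the least such $k$. -}

module Defs where

open import Data.Nat using (ℕ; _≤_)
open import Data.Fin using (Fin; zero; suc)
open import Data.Product using (Σ; ∃; _×_; _,_; proj₁; proj₂)
open import Data.Sum using (_⊎_)
open import Data.Vec using (Vec; []; _∷_; lookup)
open import Relation.Binary.PropositionalEquality using (_≡_; _≢_)

record Graph : Set where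
  field
    V    : ℕ
    E    : ℕ
    ends : Fin E → Fin V × Fin V
open Graph public

_endpointOf_ : {G : Graph} → Fin (V G) → Fin (E G) → Set
_endpointOf_ {G} v e = v ≡ proj₁ (ends G e) ⊎ v ≡ proj₂ (ends G e)

Incidence : Graph → Set
Incidence G = Σ (Fin (V G) × Fin (E G)) λ p → _endpointOf_ {G} (proj₁ p) (proj₂ p)

inc-vertex : {G : Graph} → Incidence G → Fin (V G)
inc-vertex i = proj₁ (proj₁ i)

inc-edge : {G : Graph} → Incidence G → Fin (E G)
inc-edge i = proj₂ (proj₁ i)

_∈I_ : {G : Graph} → Incidence G → Fin (V G) → Set
_∈I_ {G} i w = _endpointOf_ {G} w (inc-edge {G} i)

Conflict : {G : Graph} → Incidence G → Incidence G → Set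
Conflict {G} i j = ∃ λ (w : Fin (V G)) → (_∈I_ {G} i w) × (_∈I_ {G} j w)

IsCFIColoring : (G : Graph) (k : ℕ) → (Incidence G → Fin k) → Set
IsCFIColoring G k c =
  (i j : Incidence G) → proj₁ i ≢ proj₁ j → Conflict {G} i j → c i ≢ c j

CFIColorable : Graph → ℕ → Set
CFIColorable G k = Σ (Incidence G → Fin k) (IsCFIColoring G k)

CFIChromaticNumberIs : Graph → ℕ → Set
CFIChromaticNumberIs G k = CFIColorable G k × ((m : ℕ) → CFIColorable G m → k ≤ m)

-- K4^+ : K4 on vertices 0,1,2,3 with edge 01 subdivided by the new vertex 4.
-- Edges: 04, 41, 02, 03, 12, 13, 23.
v0 v1 v2 v3 v4 : Fin 5
v0 = zero
v1 = suc zero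
v2 = suc (suc zero)
v3 = suc (suc (suc zero))
v4 = suc (suc (suc (suc zero)))

K4⁺-edges : Vec (Fin 5 × Fin 5) 7
K4⁺-edges =
    (v0 , v4) ∷ (v4 , v1) ∷ (v0 , v2) ∷ (v0 , v3) ∷ (v1 , v2) ∷ (v1 , v3) ∷ (v2 , v3) ∷ []

K4⁺ : Graph
K4⁺ = record { V = 5 ; E = 7 ; ends = lookup K4⁺-edges }

-- Two incidences conflict exactly when their edges meet, so a colour class of a
-- conflict-free incidence colouring consists of incidences on pairwise disjoint
-- edges (two incidences of one edge always conflict).  K₄⁺ has five vertices,
-- hence no three pairwise disjoint edges, so every colour class has at most two
-- of its fourteen incidences and at least seven colours are needed.  Seven
-- suffice by an explicit colouring.
module Submission where

open import Defs
open import Data.Nat as ℕ using (_≤_)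
open import Data.Nat.Properties using (≰⇒>; *-monoˡ-<)
open import Data.Fin using (Fin; zero; suc; #_; _<_; _<?_; _≟_; combine; remQuot)
open import Data.Fin.Properties
  using (any?; all?; pigeonhole; combine-injective; combine-remQuot; <⇒≢; <-trans)
open import Data.Product using (∃-syntax; _×_; _,_; proj₁; proj₂; uncurry)
open import Data.Product.Properties using (≡-dec; ,-injective)
open import Data.Sum using (_⊎_; inj₁; inj₂)
open import Data.Empty using (⊥-elim)
open import Data.Vec using (Vec; []; _∷_; lookup)
open import Function using (_∘_)
open import Relation.Nullary using (Dec; yes; no; contradiction)
open import Relation.Nullary.Decidable using (_×-dec_; _⊎-dec_; _→-dec_; ¬?; toWitness)
open import Relation.Binary.PropositionalEquality using (_≡_; _≢_; refl; sym; trans; cong)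

private
  bit : ∀ {A : Set} → Dec A → Fin 2
  bit (yes _) = suc zero
  bit (no _)  = zero

  bit-transfer : ∀ {A B : Set} (a? : Dec A) (b? : Dec B) → bit a? ≡ bit b? → B → A
  bit-transfer (yes a) _       _ _ = a
  bit-transfer (no ¬a) (no ¬b) _ b = contradiction b ¬b

module _ {m n} (f : Fin n → Fin m) where

  Repeated : Fin n → Set
  Repeated j = ∃[ i ] i < j × f i ≡ f j

  repeated? : (j : Fin n) → Dec (Repeated j)
  repeated? j = any? λ i → (i <? j) ×-dec (f i ≟ f j)

  -- Pairing the colour with a "seen before" bit makes a repeated pair of tags
  -- carry a third, earlier index of the same colour.
  pigeonhole₃ : m ℕ.* 2 ℕ.< n →
                ∃[ i ] ∃[ j ] ∃[ k ] i < j × j < k × f i ≡ f j × f j ≡ f k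
  pigeonhole₃ m*2<n
    with j , k , j<k , tags≡ ← pigeonhole m*2<n (λ j → combine (f j) (bit (repeated? j)))
    with fj≡fk , bits≡ ← combine-injective (f j) _ (f k) _ tags≡
    with i , i<j , fi≡fj ← bit-transfer (repeated? j) (repeated? k) bits≡ (j , j<k , fj≡fk)
    = i , j , k , i<j , j<k , fi≡fj , fj≡fk

module _ (G : Graph) where

  EdgesMeet : Fin (E G) → Fin (E G) → Set
  EdgesMeet e e′ = ∃[ w ] _endpointOf_ {G} w e × _endpointOf_ {G} w e′

  endpointOf? : (w : Fin (V G)) (e : Fin (E G)) → Dec (_endpointOf_ {G} w e)
  endpointOf? w e = (w ≟ proj₁ (ends G e)) ⊎-dec (w ≟ proj₂ (ends G e))

  edgesMeet? : (e e′ : Fin (E G)) → Dec (EdgesMeet e e′)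
  edgesMeet? e e′ = any? λ w → endpointOf? w e ×-dec endpointOf? w e′

  endpoint : Fin 2 → Fin (E G) → Fin (V G)
  endpoint zero       e = proj₁ (ends G e)
  endpoint (suc zero) e = proj₂ (ends G e)

  endpoint-endpointOf : ∀ s e → _endpointOf_ {G} (endpoint s e) e
  endpoint-endpointOf zero       e = inj₁ refl
  endpoint-endpointOf (suc zero) e = inj₂ refl

  incidenceAt : Fin (E G) → Fin 2 → Incidence G
  incidenceAt e s = (endpoint s e , e) , endpoint-endpointOf s e

  side : Incidence G → Fin 2
  side (_ , inj₁ _) = zero
  side (_ , inj₂ _) = suc zero

  incidenceAt-side : (i : Incidence G) → i ≡ incidenceAt (inc-edge {G} i) (side i)
  incidenceAt-side (_ , inj₁ refl) = refl
  incidenceAt-side (_ , inj₂ refl) = refl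

  Loopless : Set
  Loopless = ∀ e → proj₁ (ends G e) ≢ proj₂ (ends G e)

  loopless? : Dec Loopless
  loopless? = all? λ e → ¬? (proj₁ (ends G e) ≟ proj₂ (ends G e))

  endpoint-injective : Loopless → ∀ {s s′} e → endpoint s e ≡ endpoint s′ e → s ≡ s′
  endpoint-injective loopless {zero}     {zero}     e _  = refl
  endpoint-injective loopless {zero}     {suc zero} e eq = ⊥-elim (loopless e eq)
  endpoint-injective loopless {suc zero} {zero}     e eq = ⊥-elim (loopless e (sym eq))
  endpoint-injective loopless {suc zero} {suc zero} e _  = refl

  incidenceAt-injective : Loopless → ∀ {e s e′ s′} →
    proj₁ (incidenceAt e s) ≡ proj₁ (incidenceAt e′ s′) → (e , s) ≡ (e′ , s′)
  incidenceAt-injective loopless {e} eq with ,-injective eq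
  ... | endpoints≡ , refl = cong (e ,_) (endpoint-injective loopless e endpoints≡)

  edgeSide : Fin (E G ℕ.* 2) → Fin (E G) × Fin 2
  edgeSide = remQuot {E G} 2

  edgeSide-injective : ∀ {k l} → edgeSide k ≡ edgeSide l → k ≡ l
  edgeSide-injective {k} {l} eq = begin
    k                             ≡⟨ sym (combine-remQuot {E G} 2 k) ⟩
    uncurry combine (edgeSide k)  ≡⟨ cong (uncurry combine) eq ⟩
    uncurry combine (edgeSide l)  ≡⟨ combine-remQuot {E G} 2 l ⟩
    l                             ∎
    where open Relation.Binary.PropositionalEquality.≡-Reasoning

  incidence : Fin (E G ℕ.* 2) → Incidence G
  incidence = uncurry incidenceAt ∘ edgeSide

  incidence-injective : Loopless → ∀ {k l} →
    proj₁ (incidence k) ≡ proj₁ (incidence l) → k ≡ l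
  incidence-injective loopless = edgeSide-injective ∘ incidenceAt-injective loopless

  NoThreeDisjointEdges : Set
  NoThreeDisjointEdges = ∀ e₁ e₂ e₃ → EdgesMeet e₁ e₂ ⊎ EdgesMeet e₂ e₃ ⊎ EdgesMeet e₁ e₃

  noThreeDisjointEdges? : Dec NoThreeDisjointEdges
  noThreeDisjointEdges? = all? λ e₁ → all? λ e₂ → all? λ e₃ →
    edgesMeet? e₁ e₂ ⊎-dec edgesMeet? e₂ e₃ ⊎-dec edgesMeet? e₁ e₃

  incidenceEdge : Fin (E G ℕ.* 2) → Fin (E G)
  incidenceEdge = inc-edge {G} ∘ incidence

  module _ (loopless : Loopless) {m} {c : Incidence G → Fin m} (cfi : IsCFIColoring G m c) where

    cfi-colours-distinct : ∀ {k l} → k ≢ l → EdgesMeet (incidenceEdge k) (incidenceEdge l) →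
                           c (incidence k) ≢ c (incidence l)
    cfi-colours-distinct k≢l = cfi (incidence _) (incidence _) (k≢l ∘ incidence-injective loopless)

    cfi-no-monochromatic-triple : NoThreeDisjointEdges → ∀ {i j k} → i < j → j < k →
      c (incidence i) ≡ c (incidence j) → c (incidence j) ≢ c (incidence k)
    cfi-no-monochromatic-triple meet {i} {j} {k} i<j j<k ci≡cj cj≡ck
      with meet (incidenceEdge i) (incidenceEdge j) (incidenceEdge k)
    ... | inj₁ ij        = cfi-colours-distinct (<⇒≢ i<j) ij ci≡cj
    ... | inj₂ (inj₁ jk) = cfi-colours-distinct (<⇒≢ j<k) jk cj≡ck
    ... | inj₂ (inj₂ ik) = cfi-colours-distinct (<⇒≢ (<-trans i<j j<k)) ik (trans ci≡cj cj≡ck)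

  CFIColorable⇒edges≤colours : Loopless → NoThreeDisjointEdges →
                               ∀ {m} → CFIColorable G m → E G ≤ m
  CFIColorable⇒edges≤colours loopless meet {m} (c , cfi) with E G ℕ.≤? m
  ... | yes E≤m = E≤m
  ... | no  E≰m
    with _ , _ , _ , i<j , j<k , ci≡cj , cj≡ck ← pigeonhole₃ (c ∘ incidence) (*-monoˡ-< 2 (≰⇒> E≰m))
    = ⊥-elim (cfi-no-monochromatic-triple loopless cfi meet i<j j<k ci≡cj cj≡ck)

  sideColouring : ∀ {k} → (Fin (E G) → Fin 2 → Fin k) → Incidence G → Fin k
  sideColouring col i = col (inc-edge {G} i) (side i)

  IsCFISideColouring : ∀ {k} → (Fin (E G) → Fin 2 → Fin k) → Set
  IsCFISideColouring col = ∀ e s e′ s′ → (e , s) ≢ (e′ , s′) → EdgesMeet e e′ → col e s ≢ col e′ s′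

  isCFISideColouring? : ∀ {k} (col : Fin (E G) → Fin 2 → Fin k) → Dec (IsCFISideColouring col)
  isCFISideColouring? col = all? λ e → all? λ s → all? λ e′ → all? λ s′ →
    ¬? (≡-dec _≟_ _≟_ (e , s) (e′ , s′)) →-dec edgesMeet? e e′ →-dec ¬? (col e s ≟ col e′ s′)

  sideColouring-isCFI : ∀ {k} {col : Fin (E G) → Fin 2 → Fin k} →
    IsCFISideColouring col → IsCFIColoring G k (sideColouring col)
  sideColouring-isCFI cfi i j i≢j = cfi _ _ _ _ λ sides≡ → i≢j (begin
    proj₁ i                                           ≡⟨ cong proj₁ (incidenceAt-side i) ⟩
    proj₁ (incidenceAt (inc-edge {G} i) (side i))     ≡⟨ cong (proj₁ ∘ uncurry incidenceAt) sides≡ ⟩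
    proj₁ (incidenceAt (inc-edge {G} j) (side j))     ≡⟨ cong proj₁ (sym (incidenceAt-side j)) ⟩
    proj₁ j                                           ∎)
    where open Relation.Binary.PropositionalEquality.≡-Reasoning

K4⁺-loopless : Loopless K4⁺
K4⁺-loopless = toWitness {a? = loopless? K4⁺} _

K4⁺-noThreeDisjointEdges : NoThreeDisjointEdges K4⁺
K4⁺-noThreeDisjointEdges = toWitness {a? = noThreeDisjointEdges? K4⁺} _

-- Row e lists the colours of the incidences at the first and second endpoint of
-- edge e, in the edge order 04, 41, 02, 03, 12, 13, 23 of K4⁺-edges.
K4⁺-colouring : Fin 7 → Fin 2 → Fin 7
K4⁺-colouring e s = lookup (lookup table e) s
  where
  table : Vec (Vec (Fin 7) 2) 7
  table = (# 0 ∷ # 1 ∷ [])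
        ∷ (# 2 ∷ # 3 ∷ [])
        ∷ (# 2 ∷ # 4 ∷ [])
        ∷ (# 5 ∷ # 6 ∷ [])
        ∷ (# 5 ∷ # 6 ∷ [])
        ∷ (# 0 ∷ # 4 ∷ [])
        ∷ (# 1 ∷ # 3 ∷ [])
        ∷ []

K4⁺-cfiColorable : CFIColorable K4⁺ 7
K4⁺-cfiColorable =
  sideColouring K4⁺ K4⁺-colouring ,
  sideColouring-isCFI K4⁺ (toWitness {a? = isCFISideColouring? K4⁺ K4⁺-colouring} _)

lemma3p3 : CFIChromaticNumberIs K4⁺ 7
lemma3p3 = K4⁺-cfiColorable ,
  λ m → CFIColorable⇒edges≤colours K4⁺ K4⁺-loopless K4⁺-noThreeDisjointEdges
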